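{- Let $w_n$ be the number of weak-ordering chains in $\mathcal{WOC}(n)$ subject to the stopping condition $x_i<x_j$ with $i<j$ (i.e. a chain contains the stopping condition if there are indices $i<j$ with $x_i<x_j$ in the chain). Then $w_n=(n-1)2^{n-1}+1$ for all $n\ge1$. The sequence starts $1,3,9,25,65,161,385,897,\dots$.
   Context: A weak-ordering chain on $x_1,\dots,x_m$ is an expression $x_{i_1}\,\mathrm{op}\,x_{i_2}\,\mathrm{op}\cdots\mathrm{op}\,x_{i_m}$, where $(i_1,\dots,i_m)$ is an ordering of $[m]=\{1,\dots,m\}$ and each $\mathrm{op}$ is $<$ or $=$; two expressions defining the same ordered set partition of $[m]$ (blocks = index sets of equal variables, ordered by increasing value) are identified. $\mathcal{WOC}(m)$ is the set of these chains. Each chain in $\mathcal{WOC}(m)$, $m\ge 2$, arises uniquely from its restriction to $x_1,\dots,x_{m-1}$ (a chain in $\mathcal{WOC}(m-1)$) by inserting $x_m$; this gives a rooted tree with root $x_1$ whose level-$m$ nodes are the elements of $\mathcal{WOC}(m)$. Given a stopping condition, the restricted generating tree of order $n$ is the part of this tree up to level $n$ in which any node whose chain contains the stopping condition has no descendants. Its leaves are the nodes at level $n$ together with the nodes containing the stopping condition. "The number of weak-ordering chains in $\mathcal{WOC}(n)$ subject to the stopping condition" means the number of leaves of this restricted tree of order $n$; equivalently, the number of chains in $\mathcal{WOC}(n)$ not containing the condition plus, for each $1\le j\le n$, the number of chains in $\mathcal{WOC}(j)$ that contain the condition while their restriction to $x_1,\dots,x_{j-1}$ does not. -}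

module Defs where

open import Data.Nat using (ℕ; zero; suc; _+_; _<ᵇ_; _≡ᵇ_)
open import Data.Bool using (Bool; true; false; _∧_; _∨_; not; if_then_else_)
open import Data.List using (List; []; _∷_; upTo; concatMap; filter; length; map; applyUpTo)
open import Data.Bool.ListAction using (all; any)
open import Data.Nat.ListAction using (sum)
open import Data.Vec using (Vec; []; _∷_; toList; init; _∷ʳ_)
open import Relation.Nullary.Decidable using (does)
open import Data.Bool.Properties using (T?)
open import Data.Nat.Properties using (_≟_)

-- A weak-ordering chain on x_1..x_m (= ordered set partition of [m]) is encoded
-- canonically by its rank vector  v : Vec ℕ m,  where v_i is the (0-based) index
-- of the block containing i in the ordered partition.  So x_i < x_j iff v_i < v_j
-- and x_i = x_j iff v_i = v_j.  Such a vector is valid iff its set of values is an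
-- initial segment {0,..,k-1} of ℕ, i.e. every r below some entry also occurs.
isWOC : ∀ {m} → Vec ℕ m → Bool
isWOC v = all (λ e → all (λ r → any (λ x → r ≡ᵇ x) l) (upTo e)) l
  where l = toList v

allVecs : (m b : ℕ) → List (Vec ℕ m)
allVecs zero    b = [] ∷ []
allVecs (suc m) b = concatMap (λ v → map (λ e → v ∷ʳ e) (upTo b)) (allVecs m b)

-- WOC(m) enumerated as a list (ranks are always < m, so this is exhaustive)
WOC : (m : ℕ) → List (Vec ℕ m)
WOC m = filter (λ v → T? (isWOC v)) (allVecs m m)

hasAsc : List ℕ → Bool
hasAsc []       = false
hasAsc (x ∷ xs) = any (λ y → x <ᵇ y) xs ∨ hasAsc xs

contains : ∀ {m} → Vec ℕ m → Bool
contains v = hasAsc (toList v)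

compress : ∀ {m} → Vec ℕ m → Vec ℕ m
compress v = Data.Vec.map (λ e → length (filter (λ r → T? ((r <ᵇ e) ∧ any (λ x → r ≡ᵇ x) l)) (upTo (suc (Data.List.foldr Data.Nat._⊔_ 0 l))))) v
  where l = toList v

restrict : ∀ {m} → Vec ℕ (suc m) → Vec ℕ m
restrict v = compress (init v)

countB : ∀ {m} → (Vec ℕ m → Bool) → List (Vec ℕ m) → ℕ
countB p xs = length (filter (λ v → T? (p v)) xs)

-- number of leaves of the restricted generating tree of order n:
-- chains in WOC(n) not containing the condition, plus for each 1 ≤ j ≤ n the
-- chains in WOC(j) containing the condition whose restriction does not.
leaves : ℕ → ℕ
leaves n = countB (λ v → not (contains v)) (WOC n)
         + sum (applyUpTo (λ k → countB (λ v → contains v ∧ not (contains (restrict v))) (WOC (suc k))) n)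

-- A chain avoids the stopping condition exactly when its rank vector is weakly decreasing, and
-- such a rank vector is a staircase h, …, 0 whose consecutive entries drop by 0 or 1; there are
-- 2^(m-1) of length m. Normalisation preserves the relative order of the entries, so a chain first
-- meets the condition at level k+1 iff its rank vector is w ++ [e] with w decreasing and e above
-- some entry of w. Validity then leaves two possibilities: w is a staircase with head h and
-- 1 ≤ e ≤ h+1, or w is a staircase except for one drop by 2 and e is the skipped value. Summing
-- over the first entry gives E(k+1) = 2 E(k) + 2^k for the number E(k) of such chains, so
-- E(k) = k 2^(k-1), and 2^(n-1) + Σ_{k<n} k 2^(k-1) = (n-1) 2^(n-1) + 1.

module Submission where

open import Defs
open import Data.Bool using (Bool; true; false; _∧_; _∨_; not; T; if_then_else_)
open import Data.Bool.ListAction using (all; any)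
open import Data.Bool.Properties
  using (T?; T-∧; T-∨; ∨-identityʳ; ∨-zeroʳ; ∨-assoc; ∧-identityʳ; ∧-zeroʳ; ∧-comm; ∧-assoc)
open import Data.Empty using (⊥; ⊥-elim)
open import Data.List using (List; []; _∷_; [_]; _++_; length; map; filter; concatMap; upTo; applyUpTo; foldr)
open import Data.List.Membership.Propositional using (_∈_)
open import Data.List.Membership.Propositional.Properties using (∈-upTo⁺; ∈-upTo⁻; ∈-++⁺ˡ; ∈-++⁺ʳ; ∈-++⁻)
open import Data.List.Properties using (map-++; map-cong; map-∘; upTo-∷ʳ; map-applyUpTo)
import Data.List.Relation.Unary.All as All
open import Data.List.Relation.Unary.All.Properties using (all⁺; all⁻)
open import Data.List.Relation.Unary.Any using (here; there)
import Data.List.Relation.Unary.Any as Any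
open import Data.List.Relation.Unary.Any.Properties using (any⁺; any⁻)
open import Data.Nat using (ℕ; zero; suc; _+_; _*_; _∸_; _^_; _≤_; _<_; _<ᵇ_; _≡ᵇ_; _⊓_; _⊔_; z≤n; s≤s; s≤s⁻¹; z<s)
open import Data.Nat.ListAction using (sum)
open import Data.Nat.ListAction.Properties using (sum-++)
open import Data.Nat.Properties
open import Data.Nat.Tactic.RingSolver using (solve-∀)
open import Data.Product using (_×_; _,_; proj₁; proj₂)
open import Data.Sum using (_⊎_; inj₁; inj₂)
open import Data.Unit using (tt)
open import Data.Vec using (Vec; toList; _∷ʳ_)
open import Data.Vec.Properties using (toList-∷ʳ; toList-map; init-∷ʳ)
open import Function using (_∘_; id)
open import Function.Bundles using (Equivalence)
open import Relation.Nullary using (¬_; yes; no)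
open import Relation.Binary.PropositionalEquality hiding ([_])

≡true : ∀ {b} → T b → b ≡ true
≡true {true} _ = refl

≡true⇒T : ∀ {b} → b ≡ true → T b
≡true⇒T refl = tt

≡false : ∀ {b} → ¬ T b → b ≡ false
≡false {false} _  = refl
≡false {true}  ¬t = ⊥-elim (¬t tt)

true≢false : true ≢ false
true≢false ()

∧-true : ∀ {a b} → a ∧ b ≡ true → a ≡ true × b ≡ true
∧-true {true} {true} _ = refl , refl

∨-true : ∀ {a b} → a ∨ b ≡ true → a ≡ true ⊎ b ≡ true
∨-true {true}  _ = inj₁ refl
∨-true {false} b = inj₂ b

∨-false : ∀ {a b} → a ∨ b ≡ false → a ≡ false × b ≡ false
∨-false {false} {false} _ = refl , refl

T⇔T⇒≡ : ∀ {a b} → (T a → T b) → (T b → T a) → a ≡ b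
T⇔T⇒≡ {false} {false} _   _   = refl
T⇔T⇒≡ {false} {true}  _   b⇒a = ⊥-elim (b⇒a tt)
T⇔T⇒≡ {true}  {false} a⇒b _   = ⊥-elim (a⇒b tt)
T⇔T⇒≡ {true}  {true}  _   _   = refl

≡ᵇ-true : ∀ {m n} → m ≡ n → (m ≡ᵇ n) ≡ true
≡ᵇ-true {m} {n} = ≡true ∘ ≡⇒≡ᵇ m n

≡ᵇ-false : ∀ {m n} → m ≢ n → (m ≡ᵇ n) ≡ false
≡ᵇ-false {m} {n} m≢n = ≡false (m≢n ∘ ≡ᵇ⇒≡ m n)

<ᵇ-true : ∀ {m n} → m < n → (m <ᵇ n) ≡ true
<ᵇ-true = ≡true ∘ <⇒<ᵇ

<ᵇ-false : ∀ {m n} → n ≤ m → (m <ᵇ n) ≡ false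
<ᵇ-false {m} {n} n≤m = ≡false (λ m<n → <⇒≱ (<ᵇ⇒< m n m<n) n≤m)

-- Counting and finite sums

𝟙 : Bool → ℕ
𝟙 true  = 1
𝟙 false = 0

𝟙-∧ : ∀ a b → 𝟙 (a ∧ b) ≡ 𝟙 a * 𝟙 b
𝟙-∧ true  b = sym (*-identityˡ (𝟙 b))
𝟙-∧ false b = refl

𝟙-∨ : ∀ a b → (a ≡ true → b ≡ true → ⊥) → 𝟙 (a ∨ b) ≡ 𝟙 a + 𝟙 b
𝟙-∨ true  true  disjoint = ⊥-elim (disjoint refl refl)
𝟙-∨ true  false _        = refl
𝟙-∨ false b     _        = refl

length-filter-filter : ∀ {A : Set} (p q : A → Bool) (xs : List A) →
  length (filter (T? ∘ q) (filter (T? ∘ p) xs)) ≡ sum (map (λ x → 𝟙 (p x ∧ q x)) xs)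
length-filter-filter p q [] = refl
length-filter-filter p q (x ∷ xs) with p x
... | false = length-filter-filter p q xs
... | true with q x
...   | false = length-filter-filter p q xs
...   | true  = cong suc (length-filter-filter p q xs)

sum-concatMap : ∀ {A B : Set} (h : B → ℕ) (f : A → List B) (xs : List A) →
  sum (map h (concatMap f xs)) ≡ sum (map (λ x → sum (map h (f x))) xs)
sum-concatMap h f [] = refl
sum-concatMap h f (x ∷ xs) = begin
  sum (map h (f x ++ concatMap f xs))               ≡⟨ cong sum (map-++ h (f x) (concatMap f xs)) ⟩
  sum (map h (f x) ++ map h (concatMap f xs))       ≡⟨ sum-++ (map h (f x)) _ ⟩
  sum (map h (f x)) + sum (map h (concatMap f xs))  ≡⟨ cong (sum (map h (f x)) +_) (sum-concatMap h f xs) ⟩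
  sum (map h (f x)) + sum (map (λ y → sum (map h (f y))) xs) ∎
  where open ≡-Reasoning

∑< : ℕ → (ℕ → ℕ) → ℕ
∑< zero    f = 0
∑< (suc b) f = ∑< b f + f b

syntax ∑< b (λ e → t) = ∑[ e < b ] t

sum-map-upTo : ∀ b (f : ℕ → ℕ) → sum (map f (upTo b)) ≡ ∑[ e < b ] f e
sum-map-upTo zero    f = refl
sum-map-upTo (suc b) f = begin
  sum (map f (upTo (suc b)))         ≡⟨ cong (sum ∘ map f) (sym (upTo-∷ʳ b)) ⟩
  sum (map f (upTo b ++ [ b ]))      ≡⟨ cong sum (map-++ f (upTo b) [ b ]) ⟩
  sum (map f (upTo b) ++ [ f b ])    ≡⟨ sum-++ (map f (upTo b)) [ f b ] ⟩
  sum (map f (upTo b)) + (f b + 0)   ≡⟨ cong₂ _+_ (sum-map-upTo b f) (+-identityʳ (f b)) ⟩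
  ∑[ e < b ] f e + f b               ∎
  where open ≡-Reasoning

∑<-cong : ∀ b {f g : ℕ → ℕ} → (∀ e → f e ≡ g e) → ∑[ e < b ] f e ≡ ∑[ e < b ] g e
∑<-cong zero    f≗g = refl
∑<-cong (suc b) f≗g = cong₂ _+_ (∑<-cong b f≗g) (f≗g b)

∑<-vanish : ∀ b (f : ℕ → ℕ) → (∀ e → e < b → f e ≡ 0) → ∑[ e < b ] f e ≡ 0
∑<-vanish zero    f f≡0 = refl
∑<-vanish (suc b) f f≡0 =
  cong₂ _+_ (∑<-vanish b f (λ e e<b → f≡0 e (m<n⇒m<1+n e<b))) (f≡0 b (n<1+n b))

∑<-+ : ∀ b (f g : ℕ → ℕ) → ∑[ e < b ] (f e + g e) ≡ ∑[ e < b ] f e + ∑[ e < b ] g e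
∑<-+ zero    f g = refl
∑<-+ (suc b) f g rewrite ∑<-+ b f g = +-interchange (∑< b f) (∑< b g) (f b) (g b)
  where
  +-interchange : ∀ a b c d → (a + b) + (c + d) ≡ (a + c) + (b + d)
  +-interchange = solve-∀

∑<-* : ∀ b k (f : ℕ → ℕ) → ∑[ e < b ] (k * f e) ≡ k * ∑[ e < b ] f e
∑<-* zero    k f = sym (*-zeroʳ k)
∑<-* (suc b) k f rewrite ∑<-* b k f = sym (*-distribˡ-+ k (∑< b f) (f b))

∑<-comm : ∀ b b′ (f : ℕ → ℕ → ℕ) → ∑[ a < b ] ∑[ c < b′ ] f a c ≡ ∑[ c < b′ ] ∑[ a < b ] f a c
∑<-comm zero    b′ f = sym (∑<-vanish b′ (λ _ → 0) (λ _ _ → refl))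
∑<-comm (suc b) b′ f = begin
  ∑[ a < b ] ∑[ c < b′ ] f a c + ∑[ c < b′ ] f b c  ≡⟨ cong (_+ ∑[ c < b′ ] f b c) (∑<-comm b b′ f) ⟩
  ∑[ c < b′ ] ∑[ a < b ] f a c + ∑[ c < b′ ] f b c  ≡⟨ sym (∑<-+ b′ _ _) ⟩
  ∑[ c < b′ ] (∑[ a < b ] f a c + f b c)            ∎
  where open ≡-Reasoning

∑<-head : ∀ b (f : ℕ → ℕ) → ∑[ e < suc b ] f e ≡ f 0 + ∑[ e < b ] f (suc e)
∑<-head zero    f = sym (+-identityʳ (f 0))
∑<-head (suc b) f rewrite ∑<-head b f = +-assoc (f 0) _ _

∑<-pointMass : ∀ b c (f : ℕ → ℕ) → c < b → ∑[ e < b ] (𝟙 (e ≡ᵇ c) * f e) ≡ f c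
∑<-pointMass (suc b) c f c<1+b with m≤n⇒m<n∨m≡n (s≤s⁻¹ c<1+b)
... | inj₁ c<b  rewrite ∑<-pointMass b c f c<b | ≡ᵇ-false (>⇒≢ c<b) = +-identityʳ (f c)
... | inj₂ refl rewrite ∑<-vanish c (λ e → 𝟙 (e ≡ᵇ c) * f e) (λ e e<c → cong (λ t → 𝟙 t * f e) (≡ᵇ-false (<⇒≢ e<c)))
                      | ≡ᵇ-true {c} refl = *-identityˡ (f c)

∑<-pointMass-if : ∀ b c d (f : ℕ → ℕ) → (d ≡ true → c < b) → ∑[ e < b ] (𝟙 (e ≡ᵇ c) * (𝟙 d * f e)) ≡ 𝟙 d * f c
∑<-pointMass-if b c true  f c<b = trans (∑<-cong b (λ e → cong (𝟙 (e ≡ᵇ c) *_) (*-identityˡ (f e))))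
                                        (trans (∑<-pointMass b c f (c<b refl)) (sym (*-identityˡ (f c))))
∑<-pointMass-if b c false f _   = ∑<-vanish b _ (λ e _ → *-zeroʳ (𝟙 (e ≡ᵇ c)))

∑<-𝟙≡ : ∀ b c → c < b → ∑[ e < b ] 𝟙 (e ≡ᵇ c) ≡ 1
∑<-𝟙≡ b c c<b = trans (∑<-cong b (λ e → sym (*-identityʳ (𝟙 (e ≡ᵇ c))))) (∑<-pointMass b c (λ _ → 1) c<b)

∑<-𝟙< : ∀ b c → ∑[ e < b ] 𝟙 (e <ᵇ c) ≡ b ⊓ c
∑<-𝟙< zero    c       = refl
∑<-𝟙< (suc b) zero    = trans (∑<-head b _) (∑<-vanish b _ (λ _ _ → refl))
∑<-𝟙< (suc b) (suc c) = trans (∑<-head b _) (cong suc (∑<-𝟙< b c))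

∑Lists : ℕ → ℕ → (List ℕ → ℕ) → ℕ
∑Lists b zero    g = g []
∑Lists b (suc m) g = ∑Lists b m (λ l → ∑[ e < b ] g (e ∷ l))

∑Lists-cong : ∀ b m {g h : List ℕ → ℕ} → (∀ l → length l ≡ m → g l ≡ h l) → ∑Lists b m g ≡ ∑Lists b m h
∑Lists-cong b zero    g≗h = g≗h [] refl
∑Lists-cong b (suc m) g≗h = ∑Lists-cong b m (λ l ∣l∣≡m → ∑<-cong b (λ e → g≗h (e ∷ l) (cong suc ∣l∣≡m)))

∑Lists-+ : ∀ b m (g h : List ℕ → ℕ) → ∑Lists b m (λ l → g l + h l) ≡ ∑Lists b m g + ∑Lists b m h
∑Lists-+ b zero    g h = refl
∑Lists-+ b (suc m) g h = trans (∑Lists-cong b m (λ l _ → ∑<-+ b _ _)) (∑Lists-+ b m _ _)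

∑Lists-* : ∀ b m k (g : List ℕ → ℕ) → ∑Lists b m (λ l → k * g l) ≡ k * ∑Lists b m g
∑Lists-* b zero    k g = refl
∑Lists-* b (suc m) k g = trans (∑Lists-cong b m (λ l _ → ∑<-* b k _)) (∑Lists-* b m k _)

∑Lists-∷ʳ : ∀ b m (g : List ℕ → ℕ) → ∑Lists b (suc m) g ≡ ∑Lists b m (λ l → ∑[ e < b ] g (l ++ [ e ]))
∑Lists-∷ʳ b zero    g = refl
∑Lists-∷ʳ b (suc m) g = trans (∑Lists-∷ʳ b m (λ l → ∑[ e < b ] g (e ∷ l)))
                              (∑Lists-cong b m (λ l _ → ∑<-comm b b (λ a c → g (c ∷ l ++ [ a ]))))

sum-allVecs-∷ʳ : ∀ b m (h : Vec ℕ (suc m) → ℕ) →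
  sum (map h (allVecs (suc m) b)) ≡ sum (map (λ w → ∑[ e < b ] h (w ∷ʳ e)) (allVecs m b))
sum-allVecs-∷ʳ b m h = trans (sum-concatMap h _ (allVecs m b))
  (cong sum (map-cong (λ w → trans (cong sum (sym (map-∘ (upTo b)))) (sum-map-upTo b _)) (allVecs m b)))

sum-allVecs : ∀ b m (g : List ℕ → ℕ) → sum (map (g ∘ toList) (allVecs m b)) ≡ ∑Lists b m g
sum-allVecs b zero    g = +-identityʳ (g [])
sum-allVecs b (suc m) g = begin
  sum (map (g ∘ toList) (allVecs (suc m) b))
    ≡⟨ sum-allVecs-∷ʳ b m (g ∘ toList) ⟩
  sum (map (λ w → ∑[ e < b ] g (toList (w ∷ʳ e))) (allVecs m b))
    ≡⟨ cong sum (map-cong (λ w → ∑<-cong b (λ e → cong g (toList-∷ʳ e w))) (allVecs m b)) ⟩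
  sum (map (λ w → ∑[ e < b ] g (toList w ++ [ e ])) (allVecs m b))
    ≡⟨ sum-allVecs b m _ ⟩
  ∑Lists b m (λ l → ∑[ e < b ] g (l ++ [ e ]))
    ≡⟨ sym (∑Lists-∷ʳ b m g) ⟩
  ∑Lists b (suc m) g ∎
  where open ≡-Reasoning

-- Normalisation preserves ascents

length-filter-mono : ∀ {A : Set} (p q : A → Bool) xs → (∀ {r} → T (p r) → T (q r)) →
  length (filter (T? ∘ p) xs) ≤ length (filter (T? ∘ q) xs)
length-filter-mono p q []       p⇒q = z≤n
length-filter-mono p q (y ∷ ys) p⇒q with p y in py | q y in qy
... | false | false = length-filter-mono p q ys p⇒q
... | false | true  = m≤n⇒m≤1+n (length-filter-mono p q ys p⇒q)
... | true  | false = ⊥-elim (subst T qy (p⇒q (≡true⇒T py)))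
... | true  | true  = s≤s (length-filter-mono p q ys p⇒q)

length-filter-< : ∀ {A : Set} (p q : A → Bool) xs {z} → (∀ {r} → T (p r) → T (q r)) →
  z ∈ xs → ¬ T (p z) → T (q z) → length (filter (T? ∘ p) xs) < length (filter (T? ∘ q) xs)
length-filter-< p q (y ∷ ys) p⇒q (here refl) ¬pz qz
  rewrite ≡false ¬pz | ≡true qz = s≤s (length-filter-mono p q ys p⇒q)
length-filter-< p q (y ∷ ys) p⇒q (there z∈ys) ¬pz qz with p y in py | q y in qy
... | false | false = length-filter-< p q ys p⇒q z∈ys ¬pz qz
... | false | true  = m<n⇒m<1+n (length-filter-< p q ys p⇒q z∈ys ¬pz qz)
... | true  | false = ⊥-elim (subst T qy (p⇒q (≡true⇒T py)))
... | true  | true  = s≤s (length-filter-< p q ys p⇒q z∈ys ¬pz qz)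

any⇒∈ : ∀ {r} l → T (any (λ x → r ≡ᵇ x) l) → r ∈ l
any⇒∈ {r} l t = Any.map (≡ᵇ⇒≡ r _) (any⁻ _ l t)

∈⇒any : ∀ {r l} → r ∈ l → T (any (λ x → r ≡ᵇ x) l)
∈⇒any {r} r∈l = any⁺ _ (Any.map (λ { refl → ≡⇒≡ᵇ r r refl }) r∈l)

∈⇒≤max : ∀ {x} l → x ∈ l → x ≤ foldr _⊔_ 0 l
∈⇒≤max (y ∷ l) (here refl)  = m≤m⊔n y _
∈⇒≤max (y ∷ l) (there x∈l) = ≤-trans (∈⇒≤max l x∈l) (m≤n⊔m y _)

occursBelow : List ℕ → ℕ → ℕ → Bool
occursBelow l e r = (r <ᵇ e) ∧ any (λ x → r ≡ᵇ x) l

occursBelow-mono : ∀ l {e e′ r} → e ≤ e′ → T (occursBelow l e r) → T (occursBelow l e′ r)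
occursBelow-mono l {e} {e′} {r} e≤e′ t with Equivalence.to T-∧ t
... | r<ᵇe , r∈l = Equivalence.from T-∧ (<⇒<ᵇ (<-≤-trans (<ᵇ⇒< r e r<ᵇe) e≤e′) , r∈l)

-- compress w unfolds to map (rank (toList w)) w.
rank : List ℕ → ℕ → ℕ
rank l e = length (filter (T? ∘ occursBelow l e) (upTo (suc (foldr _⊔_ 0 l))))

rank-<ᵇ : ∀ l {x y} → x ∈ l → y ∈ l → (rank l x <ᵇ rank l y) ≡ (x <ᵇ y)
rank-<ᵇ l {x} {y} x∈l y∈l with x <? y
... | yes x<y = trans (<ᵇ-true rank-x<rank-y) (sym (<ᵇ-true x<y))
  where
  rank-x<rank-y : rank l x < rank l y
  rank-x<rank-y = length-filter-< (occursBelow l x) (occursBelow l y) (upTo (suc (foldr _⊔_ 0 l)))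
    (occursBelow-mono l (<⇒≤ x<y))
    (∈-upTo⁺ (s≤s (∈⇒≤max l x∈l))) (λ t → <-irrefl refl (<ᵇ⇒< x x (proj₁ (Equivalence.to T-∧ t))))
    (Equivalence.from T-∧ (<⇒<ᵇ x<y , ∈⇒any x∈l))
... | no x≮y = trans (<ᵇ-false rank-y≤rank-x) (sym (<ᵇ-false (≮⇒≥ x≮y)))
  where
  rank-y≤rank-x : rank l y ≤ rank l x
  rank-y≤rank-x = length-filter-mono (occursBelow l y) (occursBelow l x) (upTo (suc (foldr _⊔_ 0 l)))
                                     (occursBelow-mono l (≮⇒≥ x≮y))

any-map-<ᵇ : ∀ (f : ℕ → ℕ) x xs → (∀ {y} → y ∈ xs → (f x <ᵇ f y) ≡ (x <ᵇ y)) →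
  any (f x <ᵇ_) (map f xs) ≡ any (x <ᵇ_) xs
any-map-<ᵇ f x []       f-refl = refl
any-map-<ᵇ f x (y ∷ xs) f-refl = cong₂ _∨_ (f-refl (here refl)) (any-map-<ᵇ f x xs (f-refl ∘ there))

hasAsc-map : ∀ (f : ℕ → ℕ) l xs → (∀ {x y} → x ∈ l → y ∈ l → (f x <ᵇ f y) ≡ (x <ᵇ y)) →
  (∀ {x} → x ∈ xs → x ∈ l) → hasAsc (map f xs) ≡ hasAsc xs
hasAsc-map f l []       f-refl xs⊆l = refl
hasAsc-map f l (x ∷ xs) f-refl xs⊆l =
  cong₂ _∨_ (any-map-<ᵇ f x xs (λ y∈xs → f-refl (xs⊆l (here refl)) (xs⊆l (there y∈xs))))
            (hasAsc-map f l xs f-refl (xs⊆l ∘ there))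

contains-compress : ∀ {m} (w : Vec ℕ m) → contains (compress w) ≡ hasAsc (toList w)
contains-compress w =
  trans (cong hasAsc (toList-map (rank (toList w)) w)) (hasAsc-map (rank (toList w)) (toList w) (toList w) (rank-<ᵇ (toList w)) id)

-- Valid rank vectors

DownClosed : List ℕ → Set
DownClosed l = ∀ {z r} → z ∈ l → r < z → r ∈ l

isWOCL : List ℕ → Bool
isWOCL l = all (λ e → all (λ r → any (λ x → r ≡ᵇ x) l) (upTo e)) l

isWOCL⇒DownClosed : ∀ l → T (isWOCL l) → DownClosed l
isWOCL⇒DownClosed l t z∈l r<z = any⇒∈ l (All.lookup (all⁺ _ _ (All.lookup (all⁺ _ l t) z∈l)) (∈-upTo⁺ r<z))

DownClosed⇒isWOCL : ∀ l → DownClosed l → T (isWOCL l)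
DownClosed⇒isWOCL l closed = all⁻ _ (All.tabulate λ z∈l → all⁻ _ (All.tabulate λ r∈ → ∈⇒any (closed z∈l (∈-upTo⁻ r∈))))

isWOCL-∷ : ∀ x m t → (∀ {z} → z ∈ t → z ≤ m) → m ∈ t → m ≤ x →
  isWOCL (x ∷ t) ≡ isWOCL t ∧ (x <ᵇ suc (suc m))
isWOCL-∷ x m t ≤m m∈t m≤x = T⇔T⇒≡ to from
  where
  to : T (isWOCL (x ∷ t)) → T (isWOCL t ∧ (x <ᵇ suc (suc m)))
  to valid = Equivalence.from T-∧ (DownClosed⇒isWOCL t closed-t , <⇒<ᵇ x<2+m)
    where
    closed = isWOCL⇒DownClosed (x ∷ t) valid
    closed-t : DownClosed t
    closed-t z∈t r<z with closed (there z∈t) r<z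
    ... | here refl = ⊥-elim (<⇒≱ r<z (≤-trans (≤m z∈t) m≤x))
    ... | there r∈t = r∈t
    x<2+m : x < suc (suc m)
    x<2+m with x <? suc (suc m)
    ... | yes x<2+m = x<2+m
    ... | no x≮2+m with closed (here refl) (≮⇒≥ x≮2+m)
    ...   | here 1+m≡x = ⊥-elim (x≮2+m (≤-reflexive (cong suc (sym 1+m≡x))))
    ...   | there 1+m∈t = ⊥-elim (1+n≰n (≤m 1+m∈t))
  from : T (isWOCL t ∧ (x <ᵇ suc (suc m))) → T (isWOCL (x ∷ t))
  from valid = DownClosed⇒isWOCL (x ∷ t) closed
    where
    closed-t = isWOCL⇒DownClosed t (proj₁ (Equivalence.to T-∧ valid))
    x≤1+m = s≤s⁻¹ (<ᵇ⇒< x _ (proj₂ (Equivalence.to T-∧ valid)))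
    closed : DownClosed (x ∷ t)
    closed (here refl) r<x with m≤n⇒m<n∨m≡n (s≤s⁻¹ (≤-trans r<x x≤1+m))
    ... | inj₁ r<m  = there (closed-t m∈t r<m)
    ... | inj₂ refl = there m∈t
    closed (there z∈t) r<z = there (closed-t z∈t r<z)

isWOCL-∷ʳ : ∀ x e u → (∀ {z} → z ∈ u → z ≤ x) → x ∈ u → x < e →
  isWOCL (u ++ [ e ]) ≡ isWOCL u ∧ (e ≡ᵇ suc x)
isWOCL-∷ʳ x e u ≤x x∈u x<e = T⇔T⇒≡ to from
  where
  to : T (isWOCL (u ++ [ e ])) → T (isWOCL u ∧ (e ≡ᵇ suc x))
  to valid = Equivalence.from T-∧ (DownClosed⇒isWOCL u closed-u , ≡⇒≡ᵇ e (suc x) e≡1+x)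
    where
    closed = isWOCL⇒DownClosed (u ++ [ e ]) valid
    closed-u : DownClosed u
    closed-u z∈u r<z with ∈-++⁻ u (closed (∈-++⁺ˡ z∈u) r<z)
    ... | inj₁ r∈u = r∈u
    ... | inj₂ (here refl) = ⊥-elim (<⇒≱ r<z (≤-trans (≤x z∈u) (<⇒≤ x<e)))
    e≡1+x : e ≡ suc x
    e≡1+x with m≤n⇒m<n∨m≡n x<e
    ... | inj₂ 1+x≡e = sym 1+x≡e
    ... | inj₁ 1+x<e with ∈-++⁻ u (closed (∈-++⁺ʳ u (here refl)) 1+x<e)
    ...   | inj₁ 1+x∈u = ⊥-elim (1+n≰n (≤x 1+x∈u))
    ...   | inj₂ (here 1+x≡e) = ⊥-elim (<-irrefl 1+x≡e 1+x<e)
  from : T (isWOCL u ∧ (e ≡ᵇ suc x)) → T (isWOCL (u ++ [ e ]))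
  from valid = DownClosed⇒isWOCL (u ++ [ e ]) closed
    where
    closed-u = isWOCL⇒DownClosed u (proj₁ (Equivalence.to T-∧ valid))
    e≡1+x = ≡ᵇ⇒≡ e (suc x) (proj₂ (Equivalence.to T-∧ valid))
    closed : DownClosed (u ++ [ e ])
    closed z∈ r<z with ∈-++⁻ u z∈
    ... | inj₁ z∈u = ∈-++⁺ˡ (closed-u z∈u r<z)
    ... | inj₂ (here refl) with m≤n⇒m<n∨m≡n (s≤s⁻¹ (subst (_ <_) e≡1+x r<z))
    ...   | inj₁ r<x  = ∈-++⁺ˡ (closed-u x∈u r<x)
    ...   | inj₂ refl = ∈-++⁺ˡ x∈u

-- Descending lists and staircases

any-false : ∀ (p : ℕ → Bool) l {z} → any p l ≡ false → z ∈ l → p z ≡ false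
any-false p l any≡false z∈l = ≡false (λ pz → subst T any≡false (any⁺ p (Any.map (λ { refl → pz }) z∈l)))

any-false⁺ : ∀ (p : ℕ → Bool) l → (∀ {z} → z ∈ l → p z ≡ false) → any p l ≡ false
any-false⁺ p []      _ = refl
any-false⁺ p (y ∷ l) all-false rewrite all-false (here refl) = any-false⁺ p l (all-false ∘ there)

hasAsc-∷-false⁻ : ∀ x l → hasAsc (x ∷ l) ≡ false → (∀ {z} → z ∈ l → z ≤ x) × hasAsc l ≡ false
hasAsc-∷-false⁻ x l noAsc with ∨-false {any (x <ᵇ_) l} noAsc
... | noneAbove , noAsc-l = (λ z∈l → ≮⇒≥ (λ x<z → subst T (any-false _ l noneAbove z∈l) (<⇒<ᵇ x<z))) , noAsc-l

hasAsc-∷-false⁺ : ∀ x l → (∀ {z} → z ∈ l → z ≤ x) → hasAsc l ≡ false → hasAsc (x ∷ l) ≡ false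
hasAsc-∷-false⁺ x l ≤x noAsc rewrite any-false⁺ (x <ᵇ_) l (<ᵇ-false ∘ ≤x) = noAsc

descending⇒≤head : ∀ y l → hasAsc (y ∷ l) ≡ false → ∀ {z} → z ∈ y ∷ l → z ≤ y
descending⇒≤head y l noAsc (here refl)  = ≤-refl
descending⇒≤head y l noAsc (there z∈l) = proj₁ (hasAsc-∷-false⁻ y l noAsc) z∈l

any-∷ʳ : ∀ (p : ℕ → Bool) l e → any p (l ++ [ e ]) ≡ any p l ∨ p e
any-∷ʳ p []      e = ∨-identityʳ (p e)
any-∷ʳ p (x ∷ l) e rewrite any-∷ʳ p l e = sym (∨-assoc (p x) _ _)

hasAsc-∷ʳ : ∀ l e → hasAsc (l ++ [ e ]) ≡ hasAsc l ∨ any (_<ᵇ e) l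
hasAsc-∷ʳ []      e = refl
hasAsc-∷ʳ (x ∷ l) e =
  trans (cong₂ _∨_ (any-∷ʳ (x <ᵇ_) l e) (hasAsc-∷ʳ l e)) (∨-interchange (any (x <ᵇ_) l) (x <ᵇ e) _ _)
  where
  ∨-interchange : ∀ a b c d → (a ∨ b) ∨ (c ∨ d) ≡ (a ∨ c) ∨ (b ∨ d)
  ∨-interchange true  b     c d = refl
  ∨-interchange false true  c d rewrite ∨-zeroʳ c = refl
  ∨-interchange false false c d = refl

oneStep : ℕ → ℕ → Bool
oneStep x y = (x ≡ᵇ y) ∨ (x ≡ᵇ suc y)

head₀ : List ℕ → ℕ
head₀ []      = 0
head₀ (x ∷ _) = x

-- staircase l: l = (h, …, 0) with every drop 0 or 1, i.e. a descending rank vector.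
-- gapped l: the same except that exactly one drop is 2, skipping the value gap l (junk otherwise).
staircase : List ℕ → Bool
staircase []          = false
staircase (x ∷ [])    = x ≡ᵇ 0
staircase (x ∷ y ∷ l) = oneStep x y ∧ staircase (y ∷ l)

gapped : List ℕ → Bool
gapped []          = false
gapped (x ∷ [])    = false
gapped (x ∷ y ∷ l) = (oneStep x y ∧ gapped (y ∷ l)) ∨ ((x ≡ᵇ suc (suc y)) ∧ staircase (y ∷ l))

gap : List ℕ → ℕ
gap []          = 0
gap (x ∷ [])    = 0
gap (x ∷ y ∷ l) = if x ≡ᵇ suc (suc y) then suc y else gap (y ∷ l)

extension : Bool → Bool → ℕ → ℕ → ℕ → Bool
extension d d₁ g h e = (d ∧ (0 <ᵇ e) ∧ (e <ᵇ suc (suc h))) ∨ (d₁ ∧ (e ≡ᵇ g))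

ascentExtension : List ℕ → ℕ → Bool
ascentExtension l = extension (staircase l) (gapped l) (gap l) (head₀ l)

oneStep-bounds : ∀ x y → oneStep x y ≡ true → y ≤ x × x ≤ suc y
oneStep-bounds x y step with ∨-true {x ≡ᵇ y} step
... | inj₁ x≡ᵇy  rewrite ≡ᵇ⇒≡ x y (≡true⇒T x≡ᵇy)         = ≤-refl , n≤1+n y
... | inj₂ x≡ᵇ1+y rewrite ≡ᵇ⇒≡ x (suc y) (≡true⇒T x≡ᵇ1+y) = n≤1+n y , ≤-refl

oneStep-<ᵇ : ∀ {x y} → y ≤ x → (x <ᵇ suc (suc y)) ≡ oneStep x y
oneStep-<ᵇ {x} {y} y≤x = T⇔T⇒≡ to from
  where
  to : T (x <ᵇ suc (suc y)) → T (oneStep x y)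
  to x<2+y with m≤n⇒m<n∨m≡n y≤x
  ... | inj₂ refl = Equivalence.from T-∨ (inj₁ (≡⇒≡ᵇ x x refl))
  ... | inj₁ y<x  = Equivalence.from T-∨ (inj₂ (≡⇒≡ᵇ x (suc y) (≤-antisym (s≤s⁻¹ (<ᵇ⇒< x _ x<2+y)) y<x)))
  from : T (oneStep x y) → T (x <ᵇ suc (suc y))
  from step = <⇒<ᵇ (s≤s (proj₂ (oneStep-bounds x y (≡true step))))

descending-∷ : ∀ x y l → y ≤ x → hasAsc (y ∷ l) ≡ false → hasAsc (x ∷ y ∷ l) ≡ false
descending-∷ x y l y≤x noAsc = hasAsc-∷-false⁺ x (y ∷ l) (λ z∈ → ≤-trans (descending⇒≤head y l noAsc z∈) y≤x) noAsc

staircase⇒descending : ∀ l → staircase l ≡ true → hasAsc l ≡ false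
staircase⇒descending (x ∷ [])    _     = refl
staircase⇒descending (x ∷ y ∷ l) stair =
  let step , stair′ = ∧-true {oneStep x y} stair
  in descending-∷ x y l (proj₁ (oneStep-bounds x y step)) (staircase⇒descending (y ∷ l) stair′)

gapped-elim : ∀ x y l {P : Set} → gapped (x ∷ y ∷ l) ≡ true →
  (oneStep x y ≡ true → gapped (y ∷ l) ≡ true → P) → (x ≡ suc (suc y) → staircase (y ∷ l) ≡ true → P) → P
gapped-elim x y l gapd viaStep viaJump with ∨-true {oneStep x y ∧ gapped (y ∷ l)} gapd
... | inj₁ steps = let step , gapd′ = ∧-true {oneStep x y} steps in viaStep step gapd′
... | inj₂ jump  = let x≡ᵇ2+y , stair = ∧-true {x ≡ᵇ suc (suc y)} jump
                   in viaJump (≡ᵇ⇒≡ x _ (≡true⇒T x≡ᵇ2+y)) stair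

gapped⇒descending : ∀ l → gapped l ≡ true → hasAsc l ≡ false
gapped⇒descending (x ∷ y ∷ l) gapd = gapped-elim x y l gapd
  (λ step gapd′ → descending-∷ x y l (proj₁ (oneStep-bounds x y step)) (gapped⇒descending (y ∷ l) gapd′))
  (λ { refl stair → descending-∷ x y l (m≤n+m y 2) (staircase⇒descending (y ∷ l) stair) })

gap<head : ∀ l → gapped l ≡ true → gap l < head₀ l
gap<head (x ∷ y ∷ l) gapd = gapped-elim x y l gapd
  (λ step gapd′ → subst (_< x) (sym (gap-step step))
                        (<-≤-trans (gap<head (y ∷ l) gapd′) (proj₁ (oneStep-bounds x y step))))
  (λ { refl _ → subst (_< suc (suc y)) (sym (gap-jump y l)) (n<1+n (suc y)) })
  where
  gap-step : oneStep x y ≡ true → gap (x ∷ y ∷ l) ≡ gap (y ∷ l)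
  gap-step step rewrite ≡ᵇ-false {x} {suc (suc y)} (λ { refl → 1+n≰n (proj₂ (oneStep-bounds x y step)) }) = refl
  gap-jump : ∀ y l → gap (suc (suc y) ∷ y ∷ l) ≡ suc y
  gap-jump y l rewrite ≡ᵇ-true {y} refl = refl

staircase⇒head<length : ∀ l → staircase l ≡ true → head₀ l < length l
staircase⇒head<length (x ∷ [])    stair rewrite ≡ᵇ⇒≡ x 0 (≡true⇒T stair) = s≤s z≤n
staircase⇒head<length (x ∷ y ∷ l) stair =
  let step , stair′ = ∧-true {oneStep x y} stair
  in s≤s (≤-trans (proj₂ (oneStep-bounds x y step)) (staircase⇒head<length (y ∷ l) stair′))

gapped⇒head≤length : ∀ l → gapped l ≡ true → head₀ l ≤ length l
gapped⇒head≤length (x ∷ y ∷ l) gapd = gapped-elim x y l gapd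
  (λ step gapd′ → ≤-trans (proj₂ (oneStep-bounds x y step)) (s≤s (gapped⇒head≤length (y ∷ l) gapd′)))
  (λ { refl stair → s≤s (staircase⇒head<length (y ∷ l) stair) })

staircase⇒¬gapped : ∀ l → staircase l ≡ true → gapped l ≡ false
staircase⇒¬gapped (x ∷ [])    _     = refl
staircase⇒¬gapped (x ∷ y ∷ l) stair =
  let step , stair′ = ∧-true {oneStep x y} stair
      x≢2+y : x ≢ suc (suc y)
      x≢2+y = λ { refl → 1+n≰n (proj₂ (oneStep-bounds x y step)) }
  in cong₂ _∨_ (trans (cong (oneStep x y ∧_) (staircase⇒¬gapped (y ∷ l) stair′)) (∧-zeroʳ _))
               (cong (_∧ staircase (y ∷ l)) (≡ᵇ-false x≢2+y))

ascending⇒¬staircase : ∀ l → hasAsc l ≡ true → staircase l ≡ false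
ascending⇒¬staircase l asc = ≡false (λ stair → true≢false (trans (sym asc) (staircase⇒descending l (≡true stair))))

ascending⇒¬gapped : ∀ l → hasAsc l ≡ true → gapped l ≡ false
ascending⇒¬gapped l asc = ≡false (λ gapd → true≢false (trans (sym asc) (gapped⇒descending l (≡true gapd))))

descending⇒isWOCL≡staircase : ∀ x l → hasAsc (x ∷ l) ≡ false → isWOCL (x ∷ l) ≡ staircase (x ∷ l)
descending⇒isWOCL≡staircase zero    []      _     = refl
descending⇒isWOCL≡staircase (suc x) []      _     = refl
descending⇒isWOCL≡staircase x       (y ∷ l) noAsc = begin
  isWOCL (x ∷ y ∷ l)                   ≡⟨ isWOCL-∷ x y (y ∷ l) (descending⇒≤head y l noAsc′) (here refl) y≤x ⟩
  isWOCL (y ∷ l) ∧ (x <ᵇ suc (suc y))  ≡⟨ cong₂ _∧_ (descending⇒isWOCL≡staircase y l noAsc′) (oneStep-<ᵇ y≤x) ⟩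
  staircase (y ∷ l) ∧ oneStep x y      ≡⟨ ∧-comm (staircase (y ∷ l)) (oneStep x y) ⟩
  oneStep x y ∧ staircase (y ∷ l)      ∎
  where
  open ≡-Reasoning
  ≤x = proj₁ (hasAsc-∷-false⁻ x (y ∷ l) noAsc)
  noAsc′ = proj₂ (hasAsc-∷-false⁻ x (y ∷ l) noAsc)
  y≤x = ≤x (here refl)

isWOCL∧descending≡staircase : ∀ x l → isWOCL (x ∷ l) ∧ not (hasAsc (x ∷ l)) ≡ staircase (x ∷ l)
isWOCL∧descending≡staircase x l with hasAsc (x ∷ l) in asc
... | true  = trans (∧-zeroʳ _) (sym (ascending⇒¬staircase (x ∷ l) asc))
... | false = trans (∧-identityʳ _) (descending⇒isWOCL≡staircase x l asc)

-- Prepending x to a descending y ∷ l: for x = y and x = y + 1 the extensions of the tail survive,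
-- for x = y + 2 only e = y + 1 (the skipped value) does, and for x > y + 2 none does.
module _ (y e : ℕ) (d d₁ : Bool) (g : ℕ) (g<y : d₁ ≡ true → g < y) where

  private
    withHead : ℕ → Bool
    withHead x = extension (oneStep x y ∧ d) ((oneStep x y ∧ d₁) ∨ ((x ≡ᵇ suc (suc y)) ∧ d))
                           (if x ≡ᵇ suc (suc y) then suc y else g) x e

    fromTail : ℕ → Bool
    fromTail x = extension d d₁ g y e ∧ (x <ᵇ suc (suc (y ⊔ e)))

    noGapAbove : ∀ {e′} → y ≤ e′ → d₁ ∧ (e′ ≡ᵇ g) ≡ false
    noGapAbove {e′} y≤e′ = ≡false λ t → let d₁-holds , e′≡ᵇg = Equivalence.to T-∧ t
                                        in <⇒≱ (g<y (≡true d₁-holds)) (subst (y ≤_) (≡ᵇ⇒≡ e′ g e′≡ᵇg) y≤e′)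

    flat : withHead y ≡ fromTail y
    flat rewrite ≡ᵇ-true {y} refl | ≡ᵇ-false (<⇒≢ (m<n+m y {2} z<s))
               | <ᵇ-true {y} {suc (suc (y ⊔ e))} (s≤s (≤-trans (m≤m⊔n y e) (n≤1+n _))) | ∨-identityʳ d₁
               | ∧-identityʳ ((d ∧ (0 <ᵇ e) ∧ (e <ᵇ suc (suc y))) ∨ (d₁ ∧ (e ≡ᵇ g))) = refl

    step : e ≤ suc y → withHead (suc y) ≡ fromTail (suc y)
    step e≤1+y rewrite ≡ᵇ-false (>⇒≢ (n<1+n y)) | ≡ᵇ-true {y} refl | ≡ᵇ-false (<⇒≢ (n<1+n y))
                     | <ᵇ-true {e} {suc (suc (suc y))} (s≤s (m≤n⇒m≤1+n e≤1+y)) | <ᵇ-true {e} {suc (suc y)} (s≤s e≤1+y)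
                     | <ᵇ-true {y} {suc (y ⊔ e)} (s≤s (m≤m⊔n y e)) | ∨-identityʳ d₁
                     | ∧-identityʳ ((d ∧ (0 <ᵇ e) ∧ true) ∨ (d₁ ∧ (e ≡ᵇ g))) = refl

    jump : e ≤ suc (suc y) → withHead (suc (suc y)) ≡ fromTail (suc (suc y))
    jump e≤2+y with m≤n⇒m<n∨m≡n e≤2+y
    ... | inj₂ refl rewrite ≡ᵇ-false (>⇒≢ (m<n+m y {2} z<s)) | ≡ᵇ-false (>⇒≢ (n<1+n y)) | ≡ᵇ-true {y} refl
          | ≡ᵇ-false (>⇒≢ (n<1+n y)) | <ᵇ-false {y} {y} ≤-refl | ∧-zeroʳ d | noGapAbove (m≤n+m y 2) = refl
    ... | inj₁ e<2+y with m≤n⇒m<n∨m≡n (s≤s⁻¹ e<2+y)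
    ...   | inj₂ refl rewrite ≡ᵇ-false (>⇒≢ (m<n+m y {2} z<s)) | ≡ᵇ-false (>⇒≢ (n<1+n y)) | ≡ᵇ-true {y} refl
            | <ᵇ-true {y} {suc y} ≤-refl | m≤n⇒m⊔n≡n (n≤1+n y) | <ᵇ-true {y} {suc y} ≤-refl
            | ≡ᵇ-true {y} refl | ∧-identityʳ d | noGapAbove (n≤1+n y) | ∨-identityʳ d | ∧-identityʳ d = refl
    ...   | inj₁ e<1+y rewrite ≡ᵇ-false (>⇒≢ (m<n+m y {2} z<s)) | ≡ᵇ-false (>⇒≢ (n<1+n y)) | ≡ᵇ-true {y} refl
            | ≡ᵇ-false (<⇒≢ e<1+y) | m≥n⇒m⊔n≡m (s≤s⁻¹ e<1+y) | <ᵇ-false {y} {y} ≤-refl | ∧-zeroʳ d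
            | ∧-zeroʳ ((d ∧ (0 <ᵇ e) ∧ (e <ᵇ suc (suc y))) ∨ (d₁ ∧ (e ≡ᵇ g))) = refl

    far : ∀ x → suc (suc y) < x → withHead x ≡ fromTail x
    far x 2+y<x rewrite ≡ᵇ-false {x} {y} (>⇒≢ (<-trans (m<n+m y {2} z<s) 2+y<x))
                      | ≡ᵇ-false {x} {suc y} (>⇒≢ (<-trans (n<1+n (suc y)) 2+y<x))
                      | ≡ᵇ-false {x} {suc (suc y)} (>⇒≢ 2+y<x)
                      with x <ᵇ suc (suc (y ⊔ e)) in x<ᵇ2+y⊔e
    ... | false = sym (∧-zeroʳ _)
    ... | true  = sym (trans (∧-identityʳ _) (cong₂ _∨_ outOfRange (noGapAbove (≤-trans (m≤n+m y 2) 2+y≤e))))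
      where
      x≤1+y⊔e : x ≤ suc (y ⊔ e)
      x≤1+y⊔e = s≤s⁻¹ (<ᵇ⇒< x _ (≡true⇒T x<ᵇ2+y⊔e))
      2+y≤e : suc (suc y) ≤ e
      2+y≤e with ⊔-sel y e
      ... | inj₁ y⊔e≡y = ⊥-elim (<⇒≱ 2+y<x (≤-trans (subst (λ k → x ≤ suc k) y⊔e≡y x≤1+y⊔e) (n≤1+n (suc y))))
      ... | inj₂ y⊔e≡e = s≤s⁻¹ (<-≤-trans 2+y<x (subst (λ k → x ≤ suc k) y⊔e≡e x≤1+y⊔e))
      outOfRange : d ∧ (0 <ᵇ e) ∧ (e <ᵇ suc (suc y)) ≡ false
      outOfRange rewrite <ᵇ-false 2+y≤e | ∧-zeroʳ (0 <ᵇ e) = ∧-zeroʳ d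

  extension-∷ : ∀ x → y ≤ x → e ≤ x → withHead x ≡ fromTail x
  extension-∷ x y≤x e≤x with m≤n⇒m<n∨m≡n y≤x
  ... | inj₂ refl = flat
  ... | inj₁ y<x with m≤n⇒m<n∨m≡n y<x
  ...   | inj₂ refl = step e≤x
  ...   | inj₁ 1+y<x with m≤n⇒m<n∨m≡n 1+y<x
  ...     | inj₂ refl = jump e≤x
  ...     | inj₁ 2+y<x = far x 2+y<x

ascentExtension-∷ : ∀ x y l e → y ≤ x → e ≤ x →
  ascentExtension (x ∷ y ∷ l) e ≡ ascentExtension (y ∷ l) e ∧ (x <ᵇ suc (suc (y ⊔ e)))
ascentExtension-∷ x y l e = extension-∷ y e (staircase (y ∷ l)) (gapped (y ∷ l)) (gap (y ∷ l)) (gap<head (y ∷ l)) x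

ascentExtension-above : ∀ x l e → x < e → ascentExtension (x ∷ l) e ≡ staircase (x ∷ l) ∧ (e ≡ᵇ suc x)
ascentExtension-above x l e x<e = trans (cong₂ _∨_ fromStaircase fromGapped) (∨-identityʳ _)
  where
  e<2+x≡e≡1+x : (e <ᵇ suc (suc x)) ≡ (e ≡ᵇ suc x)
  e<2+x≡e≡1+x with m≤n⇒m<n∨m≡n x<e
  ... | inj₂ refl  = trans (<ᵇ-true (n<1+n (suc x))) (sym (≡ᵇ-true {suc x} refl))
  ... | inj₁ 1+x<e = trans (<ᵇ-false 1+x<e) (sym (≡ᵇ-false (>⇒≢ 1+x<e)))
  fromStaircase : staircase (x ∷ l) ∧ (0 <ᵇ e) ∧ (e <ᵇ suc (suc x)) ≡ staircase (x ∷ l) ∧ (e ≡ᵇ suc x)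
  fromStaircase rewrite <ᵇ-true (<-≤-trans z<s x<e) = cong (staircase (x ∷ l) ∧_) e<2+x≡e≡1+x
  fromGapped : gapped (x ∷ l) ∧ (e ≡ᵇ gap (x ∷ l)) ≡ false
  fromGapped = ≡false λ t → let gapd , e≡ᵇgap = Equivalence.to T-∧ t
    in <-asym (gap<head (x ∷ l) (≡true gapd)) (subst (x <_) (≡ᵇ⇒≡ e _ e≡ᵇgap) x<e)

descending⇒newAscent≡ascentExtension : ∀ l e → hasAsc l ≡ false →
  isWOCL (l ++ [ e ]) ∧ any (_<ᵇ e) l ≡ ascentExtension l e
descending⇒newAscent≡ascentExtension []      e _     = ∧-zeroʳ _
descending⇒newAscent≡ascentExtension (x ∷ l) e noAsc with x <? e
... | yes x<e = begin
  isWOCL (x ∷ l ++ [ e ]) ∧ ((x <ᵇ e) ∨ any (_<ᵇ e) l)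
    ≡⟨ cong (λ b → isWOCL (x ∷ l ++ [ e ]) ∧ (b ∨ any (_<ᵇ e) l)) (<ᵇ-true x<e) ⟩
  isWOCL (x ∷ l ++ [ e ]) ∧ true
    ≡⟨ ∧-identityʳ _ ⟩
  isWOCL (x ∷ l ++ [ e ])
    ≡⟨ isWOCL-∷ʳ x e (x ∷ l) (descending⇒≤head x l noAsc) (here refl) x<e ⟩
  isWOCL (x ∷ l) ∧ (e ≡ᵇ suc x)
    ≡⟨ cong (_∧ (e ≡ᵇ suc x)) (descending⇒isWOCL≡staircase x l noAsc) ⟩
  staircase (x ∷ l) ∧ (e ≡ᵇ suc x)
    ≡⟨ sym (ascentExtension-above x l e x<e) ⟩
  ascentExtension (x ∷ l) e ∎
  where open ≡-Reasoning
descending⇒newAscent≡ascentExtension (zero ∷ [])  zero    noAsc | no _ = refl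
descending⇒newAscent≡ascentExtension (suc x ∷ []) e       noAsc | no x≮e rewrite <ᵇ-false (≮⇒≥ x≮e) = ∧-zeroʳ _
descending⇒newAscent≡ascentExtension (zero ∷ [])  (suc e) noAsc | no x≮e = ⊥-elim (x≮e z<s)
descending⇒newAscent≡ascentExtension (x ∷ y ∷ l) e noAsc | no x≮e = begin
  isWOCL (x ∷ t) ∧ ((x <ᵇ e) ∨ any (_<ᵇ e) (y ∷ l))
    ≡⟨ cong (λ b → isWOCL (x ∷ t) ∧ (b ∨ any (_<ᵇ e) (y ∷ l))) (<ᵇ-false e≤x) ⟩
  isWOCL (x ∷ t) ∧ any (_<ᵇ e) (y ∷ l)
    ≡⟨ cong (_∧ any (_<ᵇ e) (y ∷ l)) (isWOCL-∷ x (y ⊔ e) t ≤y⊔e y⊔e∈t (⊔-lub y≤x e≤x)) ⟩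
  (isWOCL t ∧ (x <ᵇ suc (suc (y ⊔ e)))) ∧ any (_<ᵇ e) (y ∷ l)
    ≡⟨ ∧-swap (isWOCL t) (x <ᵇ suc (suc (y ⊔ e))) (any (_<ᵇ e) (y ∷ l)) ⟩
  (isWOCL t ∧ any (_<ᵇ e) (y ∷ l)) ∧ (x <ᵇ suc (suc (y ⊔ e)))
    ≡⟨ cong (_∧ (x <ᵇ suc (suc (y ⊔ e)))) (descending⇒newAscent≡ascentExtension (y ∷ l) e noAsc′) ⟩
  ascentExtension (y ∷ l) e ∧ (x <ᵇ suc (suc (y ⊔ e)))
    ≡⟨ sym (ascentExtension-∷ x y l e y≤x e≤x) ⟩
  ascentExtension (x ∷ y ∷ l) e ∎
  where
  open ≡-Reasoning
  t = y ∷ l ++ [ e ]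
  e≤x = ≮⇒≥ x≮e
  noAsc′ = proj₂ (hasAsc-∷-false⁻ x (y ∷ l) noAsc)
  y≤x = proj₁ (hasAsc-∷-false⁻ x (y ∷ l) noAsc) (here refl)
  ∧-swap : ∀ a b c → (a ∧ b) ∧ c ≡ (a ∧ c) ∧ b
  ∧-swap a b c rewrite ∧-assoc a b c | ∧-comm b c = sym (∧-assoc a c b)
  ≤y⊔e : ∀ {z} → z ∈ t → z ≤ y ⊔ e
  ≤y⊔e z∈t with ∈-++⁻ (y ∷ l) z∈t
  ... | inj₁ z∈y∷l     = ≤-trans (descending⇒≤head y l noAsc′ z∈y∷l) (m≤m⊔n y e)
  ... | inj₂ (here refl) = m≤n⊔m y e
  y⊔e∈t : y ⊔ e ∈ t
  y⊔e∈t with ⊔-sel y e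
  ... | inj₁ y⊔e≡y = subst (_∈ t) (sym y⊔e≡y) (here refl)
  ... | inj₂ y⊔e≡e = subst (_∈ t) (sym y⊔e≡e) (∈-++⁺ʳ (y ∷ l) (here refl))

isWOCL∧newAscent≡ascentExtension : ∀ l e →
  isWOCL (l ++ [ e ]) ∧ (hasAsc (l ++ [ e ]) ∧ not (hasAsc l)) ≡ ascentExtension l e
isWOCL∧newAscent≡ascentExtension l e with hasAsc l in asc
... | false rewrite hasAsc-∷ʳ l e | asc | ∧-identityʳ (any (_<ᵇ e) l) = descending⇒newAscent≡ascentExtension l e asc
... | true  rewrite ∧-zeroʳ (hasAsc (l ++ [ e ])) | ∧-zeroʳ (isWOCL (l ++ [ e ]))
                  | ascending⇒¬staircase l asc | ascending⇒¬gapped l asc = refl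

-- Counting staircases and their extensions

∑<-oneStep : ∀ b y d (f : ℕ → ℕ) → (d ≡ true → suc y < b) →
  ∑[ x < b ] (𝟙 (oneStep x y ∧ d) * f x) ≡ 𝟙 d * (f y + f (suc y))
∑<-oneStep b y d f 1+y<b = begin
  ∑[ x < b ] (𝟙 (oneStep x y ∧ d) * f x)
    ≡⟨ ∑<-cong b split ⟩
  ∑[ x < b ] (𝟙 (x ≡ᵇ y) * (𝟙 d * f x) + 𝟙 (x ≡ᵇ suc y) * (𝟙 d * f x))
    ≡⟨ ∑<-+ b _ _ ⟩
  ∑[ x < b ] (𝟙 (x ≡ᵇ y) * (𝟙 d * f x)) + ∑[ x < b ] (𝟙 (x ≡ᵇ suc y) * (𝟙 d * f x))
    ≡⟨ cong₂ _+_ (∑<-pointMass-if b y d f (<-trans (n<1+n y) ∘ 1+y<b)) (∑<-pointMass-if b (suc y) d f 1+y<b) ⟩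
  𝟙 d * f y + 𝟙 d * f (suc y)
    ≡⟨ sym (*-distribˡ-+ (𝟙 d) (f y) (f (suc y))) ⟩
  𝟙 d * (f y + f (suc y)) ∎
  where
  open ≡-Reasoning
  distrib : ∀ a b c u → (a + b) * c * u ≡ a * (c * u) + b * (c * u)
  distrib = solve-∀
  split : ∀ x → 𝟙 (oneStep x y ∧ d) * f x ≡ 𝟙 (x ≡ᵇ y) * (𝟙 d * f x) + 𝟙 (x ≡ᵇ suc y) * (𝟙 d * f x)
  split x = begin
    𝟙 (oneStep x y ∧ d) * f x
      ≡⟨ cong (_* f x) (trans (𝟙-∧ (oneStep x y) d) (cong (_* 𝟙 d) (𝟙-∨ (x ≡ᵇ y) (x ≡ᵇ suc y) not-both))) ⟩
    (𝟙 (x ≡ᵇ y) + 𝟙 (x ≡ᵇ suc y)) * 𝟙 d * f x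
      ≡⟨ distrib (𝟙 (x ≡ᵇ y)) _ _ _ ⟩
    𝟙 (x ≡ᵇ y) * (𝟙 d * f x) + 𝟙 (x ≡ᵇ suc y) * (𝟙 d * f x) ∎
    where
    not-both : (x ≡ᵇ y) ≡ true → (x ≡ᵇ suc y) ≡ true → ⊥
    not-both x≡y x≡1+y = <⇒≢ (n<1+n y) (trans (sym (≡ᵇ⇒≡ x y (≡true⇒T x≡y))) (≡ᵇ⇒≡ x _ (≡true⇒T x≡1+y)))

∑-staircase-∷ : ∀ b y l → length (y ∷ l) < b → ∑[ x < b ] 𝟙 (staircase (x ∷ y ∷ l)) ≡ 2 * 𝟙 (staircase (y ∷ l))
∑-staircase-∷ b y l ∣l∣<b = begin
  ∑[ x < b ] 𝟙 (oneStep x y ∧ staircase (y ∷ l))        ≡⟨ ∑<-cong b (λ x → sym (*-identityʳ _)) ⟩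
  ∑[ x < b ] (𝟙 (oneStep x y ∧ staircase (y ∷ l)) * 1)  ≡⟨ ∑<-oneStep b y _ (λ _ → 1) 1+y<b ⟩
  𝟙 (staircase (y ∷ l)) * 2                              ≡⟨ *-comm (𝟙 (staircase (y ∷ l))) 2 ⟩
  2 * 𝟙 (staircase (y ∷ l))                              ∎
  where
  open ≡-Reasoning
  1+y<b : staircase (y ∷ l) ≡ true → suc y < b
  1+y<b stair = ≤-<-trans (staircase⇒head<length (y ∷ l) stair) ∣l∣<b

∑Lists-staircase : ∀ b m → suc m ≤ b → ∑Lists b (suc m) (𝟙 ∘ staircase) ≡ 2 ^ m
∑Lists-staircase b zero    0<b = ∑<-𝟙≡ b 0 0<b
∑Lists-staircase b (suc m) m+2≤b = begin
  ∑Lists b (suc m) (λ l → ∑[ x < b ] 𝟙 (staircase (x ∷ l)))  ≡⟨ ∑Lists-cong b (suc m) step ⟩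
  ∑Lists b (suc m) (λ l → 2 * 𝟙 (staircase l))              ≡⟨ ∑Lists-* b (suc m) 2 (𝟙 ∘ staircase) ⟩
  2 * ∑Lists b (suc m) (𝟙 ∘ staircase)                       ≡⟨ cong (2 *_) (∑Lists-staircase b m (<⇒≤ m+2≤b)) ⟩
  2 * 2 ^ m                                                  ∎
  where
  open ≡-Reasoning
  step : ∀ l → length l ≡ suc m → ∑[ x < b ] 𝟙 (staircase (x ∷ l)) ≡ 2 * 𝟙 (staircase l)
  step (y ∷ l) ∣l∣≡1+m = ∑-staircase-∷ b y l (subst (_< b) (sym ∣l∣≡1+m) m+2≤b)

extensionCount : List ℕ → ℕ
extensionCount l = 𝟙 (staircase l) * suc (head₀ l) + 𝟙 (gapped l)

∑<-between : ∀ b c → c ≤ b → ∑[ e < suc b ] 𝟙 ((0 <ᵇ e) ∧ (e <ᵇ suc c)) ≡ c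
∑<-between b c c≤b = trans (∑<-head b _) (trans (∑<-𝟙< b c) (m≥n⇒m⊓n≡n c≤b))

∑-ascentExtension : ∀ k l → length l ≡ k → ∑[ e < suc k ] 𝟙 (ascentExtension l e) ≡ extensionCount l
∑-ascentExtension k l ∣l∣≡k with staircase l in stair | gapped l in gapd
... | true  | true  = ⊥-elim (true≢false (trans (sym gapd) (staircase⇒¬gapped l stair)))
... | true  | false = begin
  ∑[ e < suc k ] 𝟙 (((0 <ᵇ e) ∧ (e <ᵇ suc (suc (head₀ l)))) ∨ false)
    ≡⟨ ∑<-cong (suc k) (λ e → cong 𝟙 (∨-identityʳ _)) ⟩
  ∑[ e < suc k ] 𝟙 ((0 <ᵇ e) ∧ (e <ᵇ suc (suc (head₀ l))))
    ≡⟨ ∑<-between k (suc (head₀ l)) head<k ⟩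
  suc (head₀ l)
    ≡⟨ sym (trans (+-identityʳ _) (*-identityˡ _)) ⟩
  1 * suc (head₀ l) + 0 ∎
  where
  open ≡-Reasoning
  head<k = subst (head₀ l <_) ∣l∣≡k (staircase⇒head<length l stair)
... | false | true  = ∑<-𝟙≡ (suc k) (gap l) (s≤s (subst (gap l ≤_) ∣l∣≡k gap≤length))
  where
  gap≤length = <⇒≤ (<-≤-trans (gap<head l gapd) (gapped⇒head≤length l gapd))
... | false | false = ∑<-vanish (suc k) _ (λ _ _ → refl)

∑-extensionCount-∷ : ∀ b y l → suc (length (y ∷ l)) < b →
  ∑[ x < b ] extensionCount (x ∷ y ∷ l) ≡ 2 * extensionCount (y ∷ l) + 2 * 𝟙 (staircase (y ∷ l))
∑-extensionCount-∷ b y l ∣l∣+1<b = begin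
  ∑[ x < b ] extensionCount (x ∷ y ∷ l)
    ≡⟨ ∑<-cong b split ⟩
  ∑[ x < b ] (𝟙 (oneStep x y ∧ d) * suc x + (𝟙 (oneStep x y ∧ d₁) * 1 + 𝟙 (x ≡ᵇ suc (suc y)) * (𝟙 d * 1)))
    ≡⟨ trans (∑<-+ b _ _) (cong (∑[ x < b ] (𝟙 (oneStep x y ∧ d) * suc x) +_) (∑<-+ b _ _)) ⟩
  ∑[ x < b ] (𝟙 (oneStep x y ∧ d) * suc x)
    + (∑[ x < b ] (𝟙 (oneStep x y ∧ d₁) * 1) + ∑[ x < b ] (𝟙 (x ≡ᵇ suc (suc y)) * (𝟙 d * 1)))
    ≡⟨ cong₂ _+_ (∑<-oneStep b y d suc (<-trans (n<1+n (suc y)) ∘ 2+y<b))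
                 (cong₂ _+_ (∑<-oneStep b y d₁ (λ _ → 1) 1+y<b) (∑<-pointMass-if b (suc (suc y)) d (λ _ → 1) 2+y<b)) ⟩
  𝟙 d * (suc y + suc (suc y)) + (𝟙 d₁ * 2 + 𝟙 d * 1)
    ≡⟨ regroup (𝟙 d) (𝟙 d₁) y ⟩
  2 * (𝟙 d * suc y + 𝟙 d₁) + 2 * 𝟙 d ∎
  where
  open ≡-Reasoning
  d  = staircase (y ∷ l)
  d₁ = gapped (y ∷ l)
  regroup : ∀ s t y → s * (suc y + suc (suc y)) + (t * 2 + s * 1) ≡ 2 * (s * suc y + t) + 2 * s
  regroup = solve-∀
  2+y<b : d ≡ true → suc (suc y) < b
  2+y<b stair = ≤-<-trans (s≤s (staircase⇒head<length (y ∷ l) stair)) ∣l∣+1<b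
  1+y<b : d₁ ≡ true → suc y < b
  1+y<b gapd = ≤-<-trans (s≤s (gapped⇒head≤length (y ∷ l) gapd)) ∣l∣+1<b
  split : ∀ x → extensionCount (x ∷ y ∷ l)
              ≡ 𝟙 (oneStep x y ∧ d) * suc x + (𝟙 (oneStep x y ∧ d₁) * 1 + 𝟙 (x ≡ᵇ suc (suc y)) * (𝟙 d * 1))
  split x = cong (𝟙 (oneStep x y ∧ d) * suc x +_) (begin
    𝟙 ((oneStep x y ∧ d₁) ∨ ((x ≡ᵇ suc (suc y)) ∧ d))
      ≡⟨ 𝟙-∨ _ _ not-both ⟩
    𝟙 (oneStep x y ∧ d₁) + 𝟙 ((x ≡ᵇ suc (suc y)) ∧ d)
      ≡⟨ cong₂ _+_ (sym (*-identityʳ _))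
                   (trans (𝟙-∧ (x ≡ᵇ suc (suc y)) d) (cong (𝟙 (x ≡ᵇ suc (suc y)) *_) (sym (*-identityʳ _)))) ⟩
    𝟙 (oneStep x y ∧ d₁) * 1 + 𝟙 (x ≡ᵇ suc (suc y)) * (𝟙 d * 1) ∎)
    where
    not-both : oneStep x y ∧ d₁ ≡ true → (x ≡ᵇ suc (suc y)) ∧ d ≡ true → ⊥
    not-both step∧gapd jump∧stair =
      true≢false (trans (sym (proj₂ (∧-true {oneStep x y} step∧gapd)))
                        (staircase⇒¬gapped (y ∷ l) (proj₂ (∧-true {x ≡ᵇ suc (suc y)} jump∧stair))))

∑Lists-extensionCount : ∀ b m → suc (suc m) ≤ b → ∑Lists b (suc m) extensionCount ≡ suc m * 2 ^ m
∑Lists-extensionCount b zero    1<b = trans (∑<-cong b (λ e → +-identityʳ _)) (∑<-pointMass b 0 suc (<-trans z<s 1<b))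
∑Lists-extensionCount b (suc m) m+3≤b = begin
  ∑Lists b (suc m) (λ l → ∑[ x < b ] extensionCount (x ∷ l))
    ≡⟨ ∑Lists-cong b (suc m) step ⟩
  ∑Lists b (suc m) (λ l → 2 * extensionCount l + 2 * 𝟙 (staircase l))
    ≡⟨ ∑Lists-+ b (suc m) (λ l → 2 * extensionCount l) (λ l → 2 * 𝟙 (staircase l)) ⟩
  ∑Lists b (suc m) (λ l → 2 * extensionCount l) + ∑Lists b (suc m) (λ l → 2 * 𝟙 (staircase l))
    ≡⟨ cong₂ _+_ (∑Lists-* b (suc m) 2 extensionCount) (∑Lists-* b (suc m) 2 (𝟙 ∘ staircase)) ⟩
  2 * ∑Lists b (suc m) extensionCount + 2 * ∑Lists b (suc m) (𝟙 ∘ staircase)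
    ≡⟨ cong₂ (λ s t → 2 * s + 2 * t) (∑Lists-extensionCount b m (<⇒≤ m+3≤b))
                                     (∑Lists-staircase b m (<⇒≤ (<⇒≤ m+3≤b))) ⟩
  2 * (suc m * 2 ^ m) + 2 * 2 ^ m
    ≡⟨ regroup m (2 ^ m) ⟩
  suc (suc m) * (2 * 2 ^ m) ∎
  where
  open ≡-Reasoning
  regroup : ∀ m x → 2 * (suc m * x) + 2 * x ≡ suc (suc m) * (2 * x)
  regroup = solve-∀
  step : ∀ l → length l ≡ suc m → ∑[ x < b ] extensionCount (x ∷ l) ≡ 2 * extensionCount l + 2 * 𝟙 (staircase l)
  step (y ∷ l) ∣l∣≡1+m = ∑-extensionCount-∷ b y l (subst (λ n → suc n < b) (sym ∣l∣≡1+m) m+3≤b)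

count-descending : ∀ m → countB (λ v → not (contains v)) (WOC (suc m)) ≡ 2 ^ m
count-descending m = begin
  countB (λ v → not (contains v)) (WOC (suc m))
    ≡⟨ length-filter-filter isWOC (not ∘ contains) (allVecs (suc m) (suc m)) ⟩
  sum (map (λ v → 𝟙 (isWOCL (toList v) ∧ not (hasAsc (toList v)))) (allVecs (suc m) (suc m)))
    ≡⟨ sum-allVecs (suc m) (suc m) (λ l → 𝟙 (isWOCL l ∧ not (hasAsc l))) ⟩
  ∑Lists (suc m) (suc m) (λ l → 𝟙 (isWOCL l ∧ not (hasAsc l)))
    ≡⟨ ∑Lists-cong (suc m) (suc m) {λ l → 𝟙 (isWOCL l ∧ not (hasAsc l))} {𝟙 ∘ staircase}
                   (λ { (x ∷ l) _ → cong 𝟙 (isWOCL∧descending≡staircase x l) }) ⟩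
  ∑Lists (suc m) (suc m) (𝟙 ∘ staircase)
    ≡⟨ ∑Lists-staircase (suc m) m ≤-refl ⟩
  2 ^ m ∎
  where open ≡-Reasoning

count-newAscent : ∀ k → countB (λ v → contains v ∧ not (contains (restrict v))) (WOC (suc k)) ≡ k * 2 ^ (k ∸ 1)
count-newAscent k = begin
  countB newAscent (WOC (suc k))
    ≡⟨ length-filter-filter isWOC newAscent (allVecs (suc k) (suc k)) ⟩
  sum (map (λ v → 𝟙 (isWOC v ∧ newAscent v)) (allVecs (suc k) (suc k)))
    ≡⟨ sum-allVecs-∷ʳ (suc k) k _ ⟩
  sum (map (λ w → ∑[ e < suc k ] 𝟙 (isWOC (w ∷ʳ e) ∧ newAscent (w ∷ʳ e))) (allVecs k (suc k)))
    ≡⟨ cong sum (map-cong (λ w → ∑<-cong (suc k) (λ e → cong 𝟙 (onLists w e))) (allVecs k (suc k))) ⟩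
  sum (map (g ∘ toList) (allVecs k (suc k)))
    ≡⟨ sum-allVecs (suc k) k g ⟩
  ∑Lists (suc k) k g
    ≡⟨ ∑Lists-cong (suc k) k (λ l ∣l∣≡k → trans (∑<-cong (suc k) (λ e → cong 𝟙 (isWOCL∧newAscent≡ascentExtension l e)))
                                                (∑-ascentExtension k l ∣l∣≡k)) ⟩
  ∑Lists (suc k) k extensionCount
    ≡⟨ closedForm k ⟩
  k * 2 ^ (k ∸ 1) ∎
  where
  open ≡-Reasoning
  newAscent : ∀ {m} → Vec ℕ (suc m) → Bool
  newAscent v = contains v ∧ not (contains (restrict v))
  g : List ℕ → ℕ
  g l = ∑[ e < suc k ] 𝟙 (isWOCL (l ++ [ e ]) ∧ (hasAsc (l ++ [ e ]) ∧ not (hasAsc l)))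
  onLists : ∀ w e → isWOC (w ∷ʳ e) ∧ newAscent (w ∷ʳ e)
                  ≡ isWOCL (toList w ++ [ e ]) ∧ (hasAsc (toList w ++ [ e ]) ∧ not (hasAsc (toList w)))
  onLists w e rewrite toList-∷ʳ e w | init-∷ʳ e w | contains-compress w = refl
  closedForm : ∀ k → ∑Lists (suc k) k extensionCount ≡ k * 2 ^ (k ∸ 1)
  closedForm zero    = refl
  closedForm (suc m) = ∑Lists-extensionCount (suc (suc m)) m ≤-refl

sum-applyUpTo : ∀ (f : ℕ → ℕ) n → sum (applyUpTo f n) ≡ ∑[ k < n ] f k
sum-applyUpTo f n = trans (cong sum (sym (map-applyUpTo id f n))) (sum-map-upTo n f)

∑<-k*2^[k∸1] : ∀ m → 2 ^ m + ∑[ k < suc m ] (k * 2 ^ (k ∸ 1)) ≡ m * 2 ^ m + 1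
∑<-k*2^[k∸1] zero    = refl
∑<-k*2^[k∸1] (suc m) = begin
  2 * 2 ^ m + (∑[ k < suc m ] (k * 2 ^ (k ∸ 1)) + suc m * 2 ^ m)
    ≡⟨ regroup _ m (2 ^ m) ⟩
  (2 ^ m + ∑[ k < suc m ] (k * 2 ^ (k ∸ 1))) + (suc m * 2 ^ m + 2 ^ m)
    ≡⟨ cong (_+ (suc m * 2 ^ m + 2 ^ m)) (∑<-k*2^[k∸1] m) ⟩
  (m * 2 ^ m + 1) + (suc m * 2 ^ m + 2 ^ m)
    ≡⟨ collect m (2 ^ m) ⟩
  suc m * (2 * 2 ^ m) + 1 ∎
  where
  open ≡-Reasoning
  regroup : ∀ s m x → 2 * x + (s + suc m * x) ≡ (x + s) + (suc m * x + x)
  regroup = solve-∀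
  collect : ∀ m x → (m * x + 1) + (suc m * x + x) ≡ suc m * (2 * x) + 1
  collect = solve-∀

theorem2 : (n : ℕ) → 1 ≤ n → leaves n ≡ (n ∸ 1) * 2 ^ (n ∸ 1) + 1
theorem2 (suc m) _ = begin
  leaves (suc m)
    ≡⟨ cong₂ _+_ (count-descending m) (trans (sum-applyUpTo _ (suc m)) (∑<-cong (suc m) count-newAscent)) ⟩
  2 ^ m + ∑[ k < suc m ] (k * 2 ^ (k ∸ 1))
    ≡⟨ ∑<-k*2^[k∸1] m ⟩
  m * 2 ^ m + 1 ∎
  where open ≡-Reasoning
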